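{- Let $n$ be a positive integer and $r$ a nonnegative integer. Then $r \in T(n,n+1)$ if and only if $r+1$ is the largest proper divisor of $n-r$.
   Context: $n \bmod k$ denotes the least nonnegative remainder of $n$ upon division by $k$. $S(n) := \{ n \bmod k : k \in \{1,2,\ldots,\lfloor n/2\rfloor\}\}$. Define $T(n,n+1) := \{ r : r \in S(n) \text{ and } r+1 \notin S(n+1)\}$. A proper divisor of a positive integer $m$ is a positive divisor of $m$ different from $m$. -}

module Defs where

open import Data.Nat using (ℕ; suc; _≤_; _<_; _∸_; _/_; _%_; NonZero)
open import Data.Nat.Divisibility using (_∣_)
open import Data.Product using (Σ; _×_)
open import Relation.Binary.PropositionalEquality using (_≡_; _≢_)
open import Relation.Nullary using (¬_)

-- n mod k for k ≥ 1, written with the divisor as suc j (so k = suc j)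
-- r ∈ S(n)  :⇔  ∃ k ∈ {1,…,⌊n/2⌋}, n mod k = r
_∈S_ : ℕ → ℕ → Set
r ∈S n = Σ ℕ (λ j → (suc j ≤ n / 2) × (n % suc j ≡ r))

_∈T_ : ℕ → ℕ → Set
r ∈T n = (r ∈S n) × ¬ (suc r ∈S suc n)

ProperDivisor : ℕ → ℕ → Set
ProperDivisor d m = (1 ≤ d) × (d ∣ m) × (d ≢ m)

IsLargestProperDivisor : ℕ → ℕ → Set
IsLargestProperDivisor d m =
  ProperDivisor d m × (∀ e → ProperDivisor e m → e ≤ d)

{-# OPTIONS --safe #-}
module Submission where

-- A remainder r ∈ S(n) is witnessed by some k with r < k and 2k ≤ n, and such a k is exactly a
-- proper divisor of n − r exceeding r.  Since (n+1) − (r+1) = n − r, membership r+1 ∈ S(n+1)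
-- likewise means n − r has a proper divisor exceeding r+1.  So r ∈ T(n,n+1) says that n − r has
-- a proper divisor ≥ r+1 but none > r+1, i.e. r+1 is its largest proper divisor.

open import Defs
open import Data.Nat using (ℕ; suc; _≤_; _<_; _∸_; _+_; _*_; _/_; _%_; NonZero; s≤s; z≤n; >-nonZero)
open import Data.Nat.Properties
open import Data.Nat.DivMod using (m≡m%n+[m/n]*n; [m+kn]%n≡m%n; m<n⇒m%n≡m; m%n<n; m/n*n≤m; m*n/n≡m; /-monoˡ-≤)
open import Data.Nat.Divisibility using (_∣_; divides; quotient; ∣⇒≤; quotient>1; m∣n⇒n≡quotient*m)
open import Data.Product using (_×_; _,_; ∃-syntax; proj₂)
open import Function using (_∘_)
open import Function.Bundles using (_⇔_; mk⇔; Equivalence)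
open import Relation.Binary.PropositionalEquality using (_≡_; _≢_; refl; sym; cong; subst; module ≡-Reasoning)
open import Relation.Nullary using (¬_)

open Equivalence using (to; from)

≤/⇔*≤ : ∀ {k n} d .{{_ : NonZero d}} → k ≤ n / d ⇔ d * k ≤ n
≤/⇔*≤ {k} {n} d = mk⇔
  (λ k≤n/d → begin
    d * k      ≡⟨ *-comm d k ⟩
    k * d      ≤⟨ *-monoˡ-≤ d k≤n/d ⟩
    n / d * d  ≤⟨ m/n*n≤m n d ⟩
    n          ∎)
  (λ dk≤n → begin
    k            ≡⟨ sym (m*n/n≡m k d) ⟩
    k * d / d    ≡⟨ cong (_/ d) (*-comm k d) ⟩
    d * k / d    ≤⟨ /-monoˡ-≤ d dk≤n ⟩
    n / d        ∎)
  where open ≤-Reasoning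

%≡⇔∣∸ : ∀ {n k r} .{{_ : NonZero k}} → r < k → r ≤ n → n % k ≡ r ⇔ k ∣ n ∸ r
%≡⇔∣∸ {n} {k} {r} r<k r≤n = mk⇔
  (λ { refl → divides (n / k) (begin
    n ∸ n % k                  ≡⟨ cong (_∸ n % k) (m≡m%n+[m/n]*n n k) ⟩
    n % k + n / k * k ∸ n % k  ≡⟨ m+n∸m≡n (n % k) (n / k * k) ⟩
    n / k * k                  ∎) })
  (λ { (divides q n∸r≡qk) → begin
    n % k              ≡⟨ cong (_% k) (sym (m+[n∸m]≡n r≤n)) ⟩
    (r + (n ∸ r)) % k  ≡⟨ cong (λ m → (r + m) % k) n∸r≡qk ⟩
    (r + q * k) % k    ≡⟨ [m+kn]%n≡m%n r q k ⟩
    r % k              ≡⟨ m<n⇒m%n≡m r<k ⟩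
    r                  ∎ })
  where open ≡-Reasoning

properDivisor⇒2*≤ : ∀ {d m} .{{_ : NonZero m}} → d ∣ m → d ≢ m → 2 * d ≤ m
properDivisor⇒2*≤ {d} {m} d∣m d≢m = begin
  2 * d             ≤⟨ *-monoˡ-≤ d (quotient>1 d∣m (≤∧≢⇒< (∣⇒≤ d∣m) d≢m)) ⟩
  quotient d∣m * d  ≡⟨ sym (m∣n⇒n≡quotient*m d∣m) ⟩
  m                 ∎
  where open ≤-Reasoning

2*≤×%≡⇔<×ProperDivisor∸ : ∀ {n k r} .{{_ : NonZero k}} → r < k →
  (2 * k ≤ n × n % k ≡ r) ⇔ (r < n × ProperDivisor k (n ∸ r))
2*≤×%≡⇔<×ProperDivisor∸ {n} {k} {r} r<k = mk⇔ remainder⇒divisor divisor⇒remainder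
  where
  0<k : 0 < k
  0<k = ≤-trans (s≤s z≤n) r<k

  remainder⇒divisor : 2 * k ≤ n × n % k ≡ r → r < n × ProperDivisor k (n ∸ r)
  remainder⇒divisor (2k≤n , n%k≡r) =
    r<n , 0<k , to (%≡⇔∣∸ r<k (<⇒≤ r<n)) n%k≡r , <⇒≢ k<n∸r
    where
    open ≤-Reasoning
    r<n : r < n
    r<n = <-≤-trans r<k (≤-trans (m≤n*m k 2) 2k≤n)
    k<n∸r : k < n ∸ r
    k<n∸r = m+n≤o⇒m≤o∸n (suc k) (begin
      suc k + r  ≡⟨ sym (+-suc k r) ⟩
      k + suc r  ≤⟨ +-monoʳ-≤ k r<k ⟩
      k + k      ≡⟨ cong (k +_) (sym (+-identityʳ k)) ⟩
      2 * k      ≤⟨ 2k≤n ⟩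
      n          ∎)

  divisor⇒remainder : r < n × ProperDivisor k (n ∸ r) → 2 * k ≤ n × n % k ≡ r
  divisor⇒remainder (r<n , _ , k∣n∸r , k≢n∸r) =
    ≤-trans 2k≤n∸r (m∸n≤m n r) , from (%≡⇔∣∸ r<k (<⇒≤ r<n)) k∣n∸r
    where
    2k≤n∸r : 2 * k ≤ n ∸ r
    2k≤n∸r = properDivisor⇒2*≤ {{>-nonZero (m<n⇒0<n∸m r<n)}} k∣n∸r k≢n∸r

∈S⇔properDivisor∸-above : ∀ r n → r ∈S n ⇔ (r < n × ∃[ k ] r < k × ProperDivisor k (n ∸ r))
∈S⇔properDivisor∸-above r n = mk⇔ witness⇒divisor divisor⇒witness
  where
  witness⇒divisor : r ∈S n → r < n × ∃[ k ] r < k × ProperDivisor k (n ∸ r)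
  witness⇒divisor (j , k≤n/2 , n%k≡r) =
    let (r<n , k-proper) = to (2*≤×%≡⇔<×ProperDivisor∸ r<k) (to (≤/⇔*≤ 2) k≤n/2 , n%k≡r)
    in r<n , suc j , r<k , k-proper
    where
    r<k : r < suc j
    r<k = subst (_< suc j) n%k≡r (m%n<n n (suc j))

  divisor⇒witness : r < n × ∃[ k ] r < k × ProperDivisor k (n ∸ r) → r ∈S n
  divisor⇒witness (r<n , suc j , r<k , k-proper) =
    let (2k≤n , n%k≡r) = from (2*≤×%≡⇔<×ProperDivisor∸ r<k) (r<n , k-proper)
    in j , from (≤/⇔*≤ 2) 2k≤n , n%k≡r

∃≥×∄>⇔greatest : ∀ (P : ℕ → Set) m →
  ((∃[ k ] m ≤ k × P k) × ¬ (∃[ k ] m < k × P k)) ⇔ (P m × (∀ k → P k → k ≤ m))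
∃≥×∄>⇔greatest P m = mk⇔
  (λ ((k , m≤k , Pk) , ∄>) →
    let bound : ∀ k → P k → k ≤ m
        bound k Pk = ≮⇒≥ (λ m<k → ∄> (k , m<k , Pk))
    in subst P (≤-antisym (bound k Pk) m≤k) Pk , bound)
  (λ (Pm , bound) → (m , ≤-refl , Pm) , λ (k , m<k , Pk) → <⇒≱ m<k (bound k Pk))

lemma4p3 : (n r : ℕ) → 1 ≤ n →
    (r ∈T n) ⇔ ((r < n) × IsLargestProperDivisor (suc r) (n ∸ r))
lemma4p3 n r _ = mk⇔
  (λ (r∈Sn , r+1∉Sn+1) →
    let (r<n , above-r) = to (∈S⇔properDivisor∸-above r n) r∈Sn
    in r<n , to (∃≥×∄>⇔greatest _ (suc r))
                (above-r , r+1∉Sn+1 ∘ from (∈S⇔properDivisor∸-above (suc r) (suc n)) ∘ (s≤s r<n ,_)))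
  (λ (r<n , largest) →
    let (above-r , none-above-r+1) = from (∃≥×∄>⇔greatest _ (suc r)) largest
    in from (∈S⇔properDivisor∸-above r n) (r<n , above-r)
     , none-above-r+1 ∘ proj₂ ∘ to (∈S⇔properDivisor∸-above (suc r) (suc n)))
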